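{- Let $n=3k$ with $k\geq 2$ an integer (so that $f_n$ is even), and let $S(n)=\langle f_n^2,f_{n+1}^2,f_{n+2}^2\rangle$. Then \[ \mathrm{Ap}(S(n),f_n^2) = \left\{ \lambda f_{n+1}^2 + \mu f_{n+2}^2 \mid (\lambda,\mu)\in (C_1 \times C_2) \setminus (C_3 \times C_4) \right\}, \] where $C_1=\{0,\dots,\frac{f_{n+3}}{2}-1\}$, $C_2=\{0,\dots,\frac{f_n}{2}-1\}$, $C_3=\{f_{n+1},\dots,\frac{f_{n+3}}{2}-1\}$, $C_4=\{f_{n-2},\dots,\frac{f_n}{2}-1\}$.
   Context: The Fibonacci numbers are defined by $f_0=0$, $f_1=1$, $f_k=f_{k-1}+f_{k-2}$ for $k\geq 2$. $\langle a_1,a_2,a_3\rangle$ denotes the set of all non-negative integer linear combinations of $a_1,a_2,a_3$; here it is a numerical semigroup (a submonoid of $(\mathbb{N},+)$ with finite complement). For a numerical semigroup $S$ and $m\in S\setminus\{0\}$, the Apéry set is $\mathrm{Ap}(S,m)=\{s\in S\mid s-m\notin S\}$. -}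

module Defs where

open import Data.Nat using (ℕ; zero; suc; _+_; _*_; _∸_; _≤_; _<_)
open import Data.Nat.DivMod using (_/_)
open import Data.Product using (Σ; ∃; _×_; _,_)
open import Relation.Binary.PropositionalEquality using (_≡_)
open import Relation.Nullary using (¬_)

fib : ℕ → ℕ
fib zero = 0
fib (suc zero) = 1
fib (suc (suc k)) = fib (suc k) + fib k

_∈⟨_,_,_⟩ : ℕ → ℕ → ℕ → ℕ → Set
s ∈⟨ a₁ , a₂ , a₃ ⟩ = ∃ λ x → ∃ λ y → ∃ λ z → x * a₁ + y * a₂ + z * a₃ ≡ s

-- membership in the Apéry set Ap(⟨a₁,a₂,a₃⟩, m) = { s ∈ S | s - m ∉ S }
-- (for s < m, s - m is negative hence not in S; we encode "s - m ∈ S" as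
--  ∃ t ∈ S with s ≡ t + m)
InApery : ℕ → ℕ → ℕ → ℕ → ℕ → Set
InApery a₁ a₂ a₃ m s =
  (s ∈⟨ a₁ , a₂ , a₃ ⟩) × ¬ (∃ λ t → (t ∈⟨ a₁ , a₂ , a₃ ⟩) × s ≡ t + m)

InRange : ℕ → ℕ → ℕ → Set
InRange lo hi i = (lo ≤ i) × (i < hi)

-- Write f = f_n = 2h and u = f_(n+1), so that f_(n+2) = u + f and f_(n+3) = 2(u + h), and put
-- g = f_(n-2), 2d = f_(n-3); then h = g + d and u = 3h + d.  An element of S lies in the Apéry
-- set iff it is the least element of S in its class modulo a = f².  Three polynomial identities,
--   (u + h)·u² = (2u + 3h)·f² + d·(u + f)²,   h·(u + f)² = (u + h)·f² + h·u²,
--   u·u² + g·(u + f)² = (3u + 4h)·f²,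
-- let every λu² + μ(u + f)² with (λ, μ) outside D = C₁ × C₂ ∖ C₃ × C₄ be lowered by a positive
-- multiple of f² inside S.  Conversely, values on D are pairwise incongruent modulo f²: since
-- λu² + μ(u + f)² ≡ u·(u(λ + μ) + 2fμ) and u is a unit modulo f² (Cassini:
-- f_(n-1) f_(n+1) = f_n² ± 1), two congruent points have λ + μ ≡ λ′ + μ′ (mod 2f), so these sums
-- are equal or differ by exactly 2f; then μ ≡ μ′ resp. μ + d ≡ μ′ (mod h), and the shape of D
-- leaves only equal points.
module Submission where

open import Data.Empty using (⊥-elim)
open import Data.Integer as ℤ using (+_; 0ℤ; 1ℤ)
open import Data.Integer.Divisibility.Signed
  using (_∣_; divides; ∣ᵤ⇒∣; ∣⇒∣ᵤ; ∣-refl; ∣-trans; ∣m⇒∣-m; ∣m+n∣n⇒∣m; ∣n⇒∣m*n; ∣m∣n⇒∣m-n)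
  renaming (*-cancelʳ-∣ to *-cancelʳ-∣ℤ)
import Data.Integer.Properties as ℤ
import Data.Integer.Tactic.RingSolver as ℤ-Ring
open import Data.Nat
open import Data.Nat.Divisibility as ℕ∣ using () renaming (_∣_ to _∣ℕ_)
open import Data.Nat.DivMod using (_/_; m*n/n≡m)
open import Data.Nat.Induction using (<-wellFounded)
open import Data.Nat.Properties
open import Data.Nat.Tactic.RingSolver
open import Data.Product using (∃; ∃-syntax; _×_; _,_; uncurry; map₂; assocʳ′; assocˡ′)
open import Data.Sum using (_⊎_; inj₁; inj₂; [_,_]′)
open import Function.Base using (_∘_)
open import Function.Bundles using (_⇔_; mk⇔; Equivalence)
open import Induction.WellFounded using (Acc; acc)
open import Relation.Binary.PropositionalEquality
open import Relation.Nullary using (¬_; Dec; yes; no)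
open import Relation.Nullary.Decidable using (_×-dec_; ¬?; decidable-stable)

open import Defs

infix 4 _≡_mod_

-- A record rather than a plain definition, so that x, y and n can be inferred from the type.
record _≡_mod_ (x y n : ℕ) : Set where
  constructor divides-difference
  field n∣x-y : + n ∣ + x ℤ.- + y

≡-mod-refl : ∀ {x n} → x ≡ x mod n
≡-mod-refl {x} = divides-difference (divides 0ℤ (ℤ.+-inverseʳ (+ x)))

module _ {x y n : ℕ} where

  ≡-mod-sym : x ≡ y mod n → y ≡ x mod n
  ≡-mod-sym (divides-difference n∣x-y) =
    divides-difference (subst (+ n ∣_) (flip (+ x) (+ y)) (∣m⇒∣-m n∣x-y))
    where
    flip : ∀ X Y → ℤ.- (X ℤ.- Y) ≡ Y ℤ.- X
    flip = ℤ-Ring.solve-∀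

  ≡-mod-weaken : ∀ {m} → m ∣ℕ n → x ≡ y mod n → x ≡ y mod m
  ≡-mod-weaken m∣n (divides-difference n∣x-y) = divides-difference (∣-trans (∣ᵤ⇒∣ m∣n) n∣x-y)

  ≡-mod-cancel-multiples : ∀ p q → x + p * n ≡ y + q * n mod n → x ≡ y mod n
  ≡-mod-cancel-multiples p q (divides-difference n∣difference) = divides-difference
    (∣m+n∣n⇒∣m (subst (+ n ∣_) difference n∣difference) (∣n⇒∣m*n (+ p ℤ.- + q) ∣-refl))
    where
    open ≡-Reasoning
    regroup : ∀ X Y P Q N → X ℤ.+ P ℤ.* N ℤ.- (Y ℤ.+ Q ℤ.* N) ≡ X ℤ.- Y ℤ.+ (P ℤ.- Q) ℤ.* N
    regroup = ℤ-Ring.solve-∀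
    difference : + (x + p * n) ℤ.- + (y + q * n) ≡ + x ℤ.- + y ℤ.+ (+ p ℤ.- + q) ℤ.* + n
    difference = begin
      + (x + p * n) ℤ.- + (y + q * n)
        ≡⟨ cong₂ ℤ._-_ (trans (ℤ.pos-+ x (p * n)) (cong (ℤ._+_ (+ x)) (ℤ.pos-* p n)))
                       (trans (ℤ.pos-+ y (q * n)) (cong (ℤ._+_ (+ y)) (ℤ.pos-* q n))) ⟩
      + x ℤ.+ + p ℤ.* + n ℤ.- (+ y ℤ.+ + q ℤ.* + n)
        ≡⟨ regroup (+ x) (+ y) (+ p) (+ q) (+ n) ⟩
      + x ℤ.- + y ℤ.+ (+ p ℤ.- + q) ℤ.* + n
        ∎

  ≡-mod-by-multiples : ∀ p q → x + p * n ≡ y + q * n → x ≡ y mod n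
  ≡-mod-by-multiples p q eq = ≡-mod-cancel-multiples p q (subst (x + p * n ≡_mod n) eq ≡-mod-refl)

  ≡-mod-by-multiple : ∀ p → x ≡ p * n + y → x ≡ y mod n
  ≡-mod-by-multiple p eq = ≡-mod-by-multiples 0 p (trans (+-identityʳ x) (trans eq (+-comm (p * n) y)))

  ≡-mod-cancelˡ-+ : ∀ k → k + x ≡ k + y mod n → x ≡ y mod n
  ≡-mod-cancelˡ-+ k (divides-difference n∣difference) = divides-difference (subst (+ n ∣_) (begin
    + (k + x) ℤ.- + (k + y)        ≡⟨ cong₂ ℤ._-_ (ℤ.pos-+ k x) (ℤ.pos-+ k y) ⟩
    + k ℤ.+ + x ℤ.- (+ k ℤ.+ + y)  ≡⟨ cancel (+ k) (+ x) (+ y) ⟩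
    + x ℤ.- + y                    ∎) n∣difference)
    where
    open ≡-Reasoning
    cancel : ∀ K X Y → K ℤ.+ X ℤ.- (K ℤ.+ Y) ≡ X ℤ.- Y
    cancel = ℤ-Ring.solve-∀

  ≡-mod-cancel-unit : ∀ u v → u * v ≡ 1 mod n → u * x ≡ u * y mod n → x ≡ y mod n
  ≡-mod-cancel-unit u v (divides-difference n∣uv-1) (divides-difference n∣ux-uy) =
    divides-difference (subst (+ n ∣_) (sym (inverse (+ u) (+ v) (+ x) (+ y)))
      (∣m∣n⇒∣m-n (∣n⇒∣m*n (+ v) (subst (+ n ∣_) (cong₂ ℤ._-_ (ℤ.pos-* u x) (ℤ.pos-* u y)) n∣ux-uy))
                 (∣n⇒∣m*n (+ x ℤ.- + y) (subst (λ w → + n ∣ w ℤ.- 1ℤ) (ℤ.pos-* u v) n∣uv-1))))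
    where
    inverse : ∀ U V X Y → X ℤ.- Y ≡ V ℤ.* (U ℤ.* X ℤ.- U ℤ.* Y) ℤ.- (X ℤ.- Y) ℤ.* (U ℤ.* V ℤ.- 1ℤ)
    inverse = ℤ-Ring.solve-∀

  ≡-mod⇒∣∸ : x ≡ y mod n → y ≤ x → n ∣ℕ x ∸ y
  ≡-mod⇒∣∸ (divides-difference n∣x-y) y≤x =
    ∣⇒∣ᵤ (subst (+ n ∣_) (trans (ℤ.[+m]-[+n]≡m⊖n x y) (ℤ.⊖-≥ y≤x)) n∣x-y)

≡-mod-cancelʳ-* : ∀ {x y n} k .{{_ : NonZero k}} → x * k ≡ y * k mod (n * k) → x ≡ y mod n
≡-mod-cancelʳ-* {x} {y} {n} k (divides-difference nk∣difference) =
  divides-difference (*-cancelʳ-∣ℤ (+ k) (subst₂ _∣_ (ℤ.pos-* n k) (begin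
    + (x * k) ℤ.- + (y * k)      ≡⟨ cong₂ ℤ._-_ (ℤ.pos-* x k) (ℤ.pos-* y k) ⟩
    + x ℤ.* + k ℤ.- + y ℤ.* + k  ≡⟨ factor (+ x) (+ y) (+ k) ⟩
    (+ x ℤ.- + y) ℤ.* + k        ∎) nk∣difference))
  where
  open ≡-Reasoning
  factor : ∀ X Y K → X ℤ.* K ℤ.- Y ℤ.* K ≡ (X ℤ.- Y) ℤ.* K
  factor = ℤ-Ring.solve-∀

adjacent⇒invertible : ∀ {w u n} → w * u + 1 ≡ n ⊎ w * u ≡ n + 1 → u * (u * w * w) ≡ 1 mod n
adjacent⇒invertible {w} {u} (inj₁ refl) = ≡-mod-by-multiples 1 (w * u) (identity w u)
  where
  identity : ∀ w u → u * (u * w * w) + 1 * (w * u + 1) ≡ 1 + w * u * (w * u + 1)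
  identity = solve-∀
adjacent⇒invertible {w} {u} {n} (inj₂ wu≡n+1) =
  ≡-mod-by-multiple (n + 2) (trans (square w u) (trans (cong (λ x → x * x) wu≡n+1) (identity n)))
  where
  square : ∀ w u → u * (u * w * w) ≡ w * u * (w * u)
  square = solve-∀
  identity : ∀ n → (n + 1) * (n + 1) ≡ (n + 2) * n + 1
  identity = solve-∀

∣∧<2*⇒≡0⊎≡ : ∀ {n k} → n ∣ℕ k → k < n + n → k ≡ 0 ⊎ k ≡ n
∣∧<2*⇒≡0⊎≡     (ℕ∣.divides zero          refl) _    = inj₁ refl
∣∧<2*⇒≡0⊎≡ {n} (ℕ∣.divides 1             refl) _    = inj₂ (+-identityʳ n)
∣∧<2*⇒≡0⊎≡ {n} (ℕ∣.divides (suc (suc q)) refl) k<2n =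
  ⊥-elim (<⇒≱ k<2n (subst (_≤ suc (suc q) * n) (cong (_+_ n) (+-identityʳ n)) (*-monoˡ-≤ n (m≤m+n 2 q))))

≡-mod∧<⇒≤ : ∀ {x y n} → x ≡ y mod n → y ≤ x → x < n → x ≤ y
≡-mod∧<⇒≤ {x} {y} {n} x≡y y≤x x<n =
  [ m∸n≡0⇒m≤n , (λ x∸y≡n → ⊥-elim (<⇒≢ x∸y<n x∸y≡n)) ]′
    (∣∧<2*⇒≡0⊎≡ (≡-mod⇒∣∸ x≡y y≤x) (<-≤-trans x∸y<n (m≤m+n n n)))
  where
  x∸y<n : x ∸ y < n
  x∸y<n = ≤-<-trans (m∸n≤m x y) x<n

≡-mod⇒≡ : ∀ {x y n} → x ≡ y mod n → x < n → y < n → x ≡ y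
≡-mod⇒≡ {x} {y} x≡y x<n y<n with ≤-total y x
... | inj₁ y≤x = ≤-antisym (≡-mod∧<⇒≤ x≡y y≤x x<n) y≤x
... | inj₂ x≤y = ≤-antisym x≤y (≡-mod∧<⇒≤ (≡-mod-sym x≡y) x≤y y<n)

module AperyFromDomain
  (a b c : ℕ) .{{_ : NonZero a}}
  (D : ℕ → ℕ → Set) (D? : ∀ y z → Dec (D y z))
  (reducible : ∀ {y z} → ¬ D y z →
    ∃[ x ] ∃[ y′ ] ∃[ z′ ] y * b + z * c ≡ suc x * a + y′ * b + z′ * c)
  (incongruent : ∀ {l m y z} → D l m → D y z →
    l * b + m * c ≡ y * b + z * c mod a → l * b + m * c ≡ y * b + z * c)
  where

  private
    peel : ∀ x y z → suc x * a + y * b + z * c ≡ x * a + y * b + z * c + a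
    peel x y z = regroup x a (y * b) (z * c)
      where
      regroup : ∀ x A w₁ w₂ → (1 + x) * A + w₁ + w₂ ≡ x * A + w₁ + w₂ + A
      regroup = solve-∀

    <-multiple+ : ∀ k w → w < suc k * a + w
    <-multiple+ k w = m<n+m w (<-≤-trans (>-nonZero⁻¹ a) (m≤m+n a (k * a)))

    absorb : ∀ x {y z X y′ z′} → y * b + z * c ≡ X * a + y′ * b + z′ * c →
             x * a + y * b + z * c ≡ (x + X) * a + y′ * b + z′ * c
    absorb x {y} {z} {X} {y′} {z′} eq = begin
      x * a + y * b + z * c            ≡⟨ +-assoc (x * a) (y * b) (z * c) ⟩
      x * a + (y * b + z * c)          ≡⟨ cong (_+_ (x * a)) eq ⟩
      x * a + (X * a + y′ * b + z′ * c) ≡⟨ collect x X a (y′ * b) (z′ * c) ⟩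
      (x + X) * a + y′ * b + z′ * c    ∎
      where
      open ≡-Reasoning
      collect : ∀ x X A w₁ w₂ → x * A + (X * A + w₁ + w₂) ≡ (x + X) * A + w₁ + w₂
      collect = solve-∀

    <-by-multiple : ∀ {v} k y z → v ≡ suc k * a + y * b + z * c → y * b + z * c < v
    <-by-multiple {v} k y z eq =
      subst (y * b + z * c <_) (trans (sym (+-assoc (suc k * a) (y * b) (z * c))) (sym eq))
            (<-multiple+ k (y * b + z * c))

  Reduces : ℕ → ℕ → Set
  Reduces y z = ∃[ x ] ∃[ y′ ] ∃[ z′ ] D y′ z′ × y * b + z * c ≡ x * a + y′ * b + z′ * c

  reduce : ∀ y z → Acc _<_ (y * b + z * c) → Reduces y z
  reduce y z _ with D? y z
  ... | yes yz∈D = 0 , y , z , yz∈D , refl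
  reduce y z (acc smaller) | no yz∉D =
    let (x , y₁ , z₁ , eq) = reducible yz∉D
        (X , y′ , z′ , y′z′∈D , eq′) = reduce y₁ z₁ (smaller (<-by-multiple x y₁ z₁ eq))
    in suc x + X , y′ , z′ , y′z′∈D , trans eq (absorb (suc x) {y₁} {z₁} {X} {y′} {z′} eq′)

  apery⇒D : ∀ {s} → InApery a b c a s → ∃[ l ] ∃[ m ] D l m × s ≡ l * b + m * c
  apery⇒D ((suc x , y , z , eq) , s-a∉S) =
    ⊥-elim (s-a∉S (x * a + y * b + z * c , (x , y , z , refl) , trans (sym eq) (peel x y z)))
  apery⇒D ((zero , y , z , eq) , s-a∉S) with D? y z
  ... | yes yz∈D = y , z , yz∈D , sym eq
  ... | no yz∉D =
    let (x , y′ , z′ , eq′) = reducible yz∉D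
    in ⊥-elim (s-a∉S (x * a + y′ * b + z′ * c , (x , y′ , z′ , refl) ,
                      trans (sym eq) (trans eq′ (peel x y′ z′))))

  D⇒apery : ∀ {s l m} → D l m → s ≡ l * b + m * c → InApery a b c a s
  D⇒apery {l = l} {m} lm∈D refl = (0 , l , m , refl) , λ where
    (_ , (x , y , z , refl) , s≡t+a) →
      let (X , y′ , z′ , y′z′∈D , eq) = reduce y z (<-wellFounded _)
          s≡ : l * b + m * c ≡ suc (x + X) * a + y′ * b + z′ * c
          s≡ = trans s≡t+a (trans (sym (peel x y z)) (absorb (suc x) {y} {z} {X} {y′} {z′} eq))
          s≡y′z′ : l * b + m * c ≡ y′ * b + z′ * c
          s≡y′z′ = incongruent lm∈D y′z′∈D
            (≡-mod-by-multiple (suc (x + X)) (trans s≡ (+-assoc (suc (x + X) * a) (y′ * b) (z′ * c))))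
      in <-irrefl refl (<-by-multiple (x + X) y′ z′ (trans (sym s≡y′z′) s≡))

  apery : ∀ s → InApery a b c a s ⇔ (∃[ l ] ∃[ m ] D l m × s ≡ l * b + m * c)
  apery s = mk⇔ apery⇒D (λ (l , m , lm∈D , eq) → D⇒apery lm∈D eq)

fib-+ : ∀ i j → fib (i + suc j) ≡ fib (suc i) * fib (suc j) + fib i * fib j
fib-+ zero j = sym (trans (+-identityʳ _) (+-identityʳ _))
fib-+ (suc i) j = begin
  fib (suc i + suc j)                                   ≡⟨ cong fib (+-suc i (suc j)) ⟨
  fib (i + suc (suc j))                                 ≡⟨ fib-+ i (suc j) ⟩
  fib (suc i) * fib (suc (suc j)) + fib i * fib (suc j)
    ≡⟨ regroup (fib (suc i)) (fib i) (fib (suc j)) (fib j) ⟩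
  fib (suc (suc i)) * fib (suc j) + fib (suc i) * fib j ∎
  where
  open ≡-Reasoning
  regroup : ∀ p q x y → p * (x + y) + q * x ≡ (p + q) * x + p * y
  regroup = solve-∀

2∣fib[3k] : ∀ k → 2 ∣ℕ fib (3 * k)
2∣fib[3k] zero    = ℕ∣.divides 0 refl
2∣fib[3k] (suc k) = subst (λ n → 2 ∣ℕ fib n) (sym (*-suc 3 k))
  (subst (2 ∣ℕ_) (sym (fib-+ 2 (3 * k)))
    (ℕ∣.∣m∣n⇒∣m+n (ℕ∣.m∣m*n (fib (suc (3 * k)))) (ℕ∣.∣n⇒∣m*n 1 (2∣fib[3k] k))))

0<fib[1+n] : ∀ n → 0 < fib (suc n)
0<fib[1+n] zero    = z<s
0<fib[1+n] (suc n) = <-≤-trans (0<fib[1+n] n) (m≤m+n (fib (suc n)) (fib n))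

cassini : ∀ n → fib n * fib (2 + n) + 1 ≡ fib (1 + n) * fib (1 + n)
              ⊎ fib n * fib (2 + n) ≡ fib (1 + n) * fib (1 + n) + 1
cassini zero = inj₁ refl
cassini (suc n) with cassini n
... | inj₁ below = inj₂ (begin
  x * (x + y + x)               ≡⟨ split x y ⟩
  x * (x + y) + x * x           ≡⟨ cong (_+_ (x * (x + y))) below ⟨
  x * (x + y) + (y * (x + y) + 1) ≡⟨ square x y ⟩
  (x + y) * (x + y) + 1         ∎)
  where
  open ≡-Reasoning
  x y : ℕ
  x = fib (suc n)
  y = fib n
  split : ∀ x y → x * (x + y + x) ≡ x * (x + y) + x * x
  split = solve-∀
  square : ∀ x y → x * (x + y) + (y * (x + y) + 1) ≡ (x + y) * (x + y) + 1
  square = solve-∀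
... | inj₂ above = inj₁ (begin
  x * (x + y + x) + 1           ≡⟨ split x y ⟩
  x * (x + y) + (x * x + 1)     ≡⟨ cong (_+_ (x * (x + y))) above ⟨
  x * (x + y) + y * (x + y)     ≡⟨ square x y ⟩
  (x + y) * (x + y)             ∎)
  where
  open ≡-Reasoning
  x y : ℕ
  x = fib (suc n)
  y = fib n
  split : ∀ x y → x * (x + y + x) + 1 ≡ x * (x + y) + (x * x + 1)
  split = solve-∀
  square : ∀ x y → x * (x + y) + y * (x + y) ≡ (x + y) * (x + y)
  square = solve-∀

AperyDescription : (f₀ f₁ f₂ L M g s : ℕ) → Set
AperyDescription f₀ f₁ f₂ L M g s =
  InApery (f₀ * f₀) (f₁ * f₁) (f₂ * f₂) (f₀ * f₀) s
  ⇔ (∃ λ l → ∃ λ μ →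
      (InRange 0 L l × InRange 0 M μ)
      × ¬ (InRange f₁ L l × InRange g M μ)
      × s ≡ l * (f₁ * f₁) + μ * (f₂ * f₂))

inRange? : ∀ lo hi i → Dec (InRange lo hi i)
inRange? lo hi i = (lo ≤? i) ×-dec (i <? hi)

reduction₁ : ∀ g d y z → let h = g + d; f = 2 * h; u = 3 * h + d in
  (u + h + y) * (u * u) + z * ((u + f) * (u + f))
    ≡ (2 * u + 3 * h) * (f * f) + y * (u * u) + (z + d) * ((u + f) * (u + f))
reduction₁ = solve-∀

reduction₂ : ∀ g d y z → let h = g + d; f = 2 * h; u = 3 * h + d in
  y * (u * u) + (h + z) * ((u + f) * (u + f))
    ≡ (u + h) * (f * f) + (y + h) * (u * u) + z * ((u + f) * (u + f))
reduction₂ = solve-∀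

reduction₃ : ∀ g d y z → let h = g + d; f = 2 * h; u = 3 * h + d in
  (u + y) * (u * u) + (g + z) * ((u + f) * (u + f))
    ≡ (3 * u + 4 * h) * (f * f) + y * (u * u) + z * ((u + f) * (u + f))
reduction₃ = solve-∀

value≡u*κ+m*a : ∀ u f l m →
  l * (u * u) + m * ((u + f) * (u + f)) ≡ u * (u * (l + m) + m * (2 * f)) + m * (f * f)
value≡u*κ+m*a = solve-∀

square-of-double : ∀ h → 2 * h * (2 * h) ≡ h * (2 * (2 * h))
square-of-double = solve-∀

-- For n = 3 + j: g = f_(n-2) = suc e and 2d = f_(n-3).
module FundamentalDomain (d e : ℕ) where

  g h f u : ℕ
  g = suc e
  h = g + d
  f = 2 * h
  u = 3 * h + d

  a b c : ℕ
  a = f * f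
  b = u * u
  c = (u + f) * (u + f)

  Box Corner D : ℕ → ℕ → Set
  Box l m = InRange 0 (u + h) l × InRange 0 h m
  Corner l m = InRange u (u + h) l × InRange g h m
  D l m = Box l m × ¬ Corner l m

  Corner? : ∀ l m → Dec (Corner l m)
  Corner? l m = inRange? u (u + h) l ×-dec inRange? g h m

  D? : ∀ l m → Dec (D l m)
  D? l m = (inRange? 0 (u + h) l ×-dec inRange? 0 h m) ×-dec ¬? (Corner? l m)

  outside : ∀ {y z} → ¬ D y z → u + h ≤ y ⊎ h ≤ z ⊎ Corner y z
  outside {y} {z} y,z∉D with u + h ≤? y | h ≤? z
  ... | yes u+h≤y | _       = inj₁ u+h≤y
  ... | no _      | yes h≤z = inj₂ (inj₁ h≤z)
  ... | no u+h≰y  | no h≰z  = inj₂ (inj₂ (decidable-stable (Corner? y z)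
          (λ ¬corner → y,z∉D (((z≤n , ≰⇒> u+h≰y) , (z≤n , ≰⇒> h≰z)) , ¬corner))))

  -- Since g = suc e, every coefficient of a below is a successor, so pred loses nothing.
  reducible : ∀ {y z} → ¬ D y z → ∃[ x ] ∃[ y′ ] ∃[ z′ ] y * b + z * c ≡ suc x * a + y′ * b + z′ * c
  reducible y,z∉D with outside y,z∉D
  reducible {z = z} _ | inj₁ u+h≤y with y₀ , refl ← m≤n⇒∃[o]m+o≡n u+h≤y =
    pred (2 * u + 3 * h) , y₀ , z + d , reduction₁ g d y₀ z
  reducible {y = y} _ | inj₂ (inj₁ h≤z) with z₀ , refl ← m≤n⇒∃[o]m+o≡n h≤z =
    pred (u + h) , y + h , z₀ , reduction₂ g d y z₀
  reducible _ | inj₂ (inj₂ ((u≤y , _) , (g≤z , _)))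
    with y₀ , refl ← m≤n⇒∃[o]m+o≡n u≤y | z₀ , refl ← m≤n⇒∃[o]m+o≡n g≤z =
    pred (3 * u + 4 * h) , y₀ , z₀ , reduction₃ g d y₀ z₀

  2f∣a : 2 * f ∣ℕ a
  2f∣a = ℕ∣.divides h (square-of-double h)

  d<h : d < h
  d<h = m<n+m d z<s

  sum-bound : u + h + h ≤ 2 * f + 2 * f
  sum-bound = subst (u + h + h ≤_) (slack g d) (m≤m+n (u + h + h) (3 * g + 2 * d))
    where
    slack : ∀ g d → let h = g + d; f = 2 * h; u = 3 * h + d in
            u + h + h + (3 * g + 2 * d) ≡ 2 * f + 2 * f
    slack = solve-∀

  sum-cases : ∀ {l m y z} → D l m → y + z ≤ l + m → l + m ≡ y + z mod (2 * f) →
              l + m ≡ y + z ⊎ l + m ≡ y + z + 2 * f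
  sum-cases {l} {m} {y} {z} (((_ , l<u+h) , (_ , m<h)) , _) y+z≤l+m congruent
    with ∣∧<2*⇒≡0⊎≡ (≡-mod⇒∣∸ congruent y+z≤l+m)
           (≤-<-trans (m∸n≤m (l + m) (y + z)) (<-≤-trans (+-mono-< l<u+h m<h) sum-bound))
  ... | inj₁ l+m∸y+z≡0  = inj₁ (≤-antisym (m∸n≡0⇒m≤n l+m∸y+z≡0) y+z≤l+m)
  ... | inj₂ l+m∸y+z≡2f = inj₂ (begin
    l + m                   ≡⟨ m∸n+n≡m y+z≤l+m ⟨
    (l + m) ∸ (y + z) + (y + z) ≡⟨ cong (_+ (y + z)) l+m∸y+z≡2f ⟩
    2 * f + (y + z)         ≡⟨ +-comm (2 * f) (y + z) ⟩
    y + z + 2 * f           ∎)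
    where open ≡-Reasoning

  excess-is-g : ∀ {m z} → d + m ≡ z mod h → z < d + m → m < h → m ≡ g + z
  excess-is-g {m} {z} d+m≡z z<d+m m<h
    with ∣∧<2*⇒≡0⊎≡ (≡-mod⇒∣∸ d+m≡z (<⇒≤ z<d+m)) (≤-<-trans (m∸n≤m (d + m) z) (+-mono-< d<h m<h))
  ... | inj₁ d+m∸z≡0 = ⊥-elim (<⇒≱ z<d+m (m∸n≡0⇒m≤n d+m∸z≡0))
  ... | inj₂ d+m∸z≡h = +-cancelˡ-≡ d m (g + z) (begin
    d + m          ≡⟨ m∸n+n≡m (<⇒≤ z<d+m) ⟨
    d + m ∸ z + z  ≡⟨ cong (_+ z) d+m∸z≡h ⟩
    g + d + z      ≡⟨ regroup g d z ⟩
    d + (g + z)    ∎)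
    where
    open ≡-Reasoning
    regroup : ∀ g d z → g + d + z ≡ d + (g + z)
    regroup = solve-∀

  value κ : ℕ → ℕ → ℕ
  value l m = l * b + m * c
  κ l m = u * (l + m) + m * (2 * f)

  module _ {v : ℕ} (u-invertible : u * v ≡ 1 mod a) where

    κ-congruent : ∀ {l m y z} → l * b + m * c ≡ y * b + z * c mod a → κ l m ≡ κ y z mod a
    κ-congruent {l} {m} {y} {z} congruent =
      ≡-mod-cancel-unit u v u-invertible (≡-mod-cancel-multiples m z
        (subst₂ (λ p q → p ≡ q mod a) (value≡u*κ+m*a u f l m) (value≡u*κ+m*a u f y z) congruent))

    sums-congruent : ∀ {l m y z} → κ l m ≡ κ y z mod a → l + m ≡ y + z mod (2 * f)
    sums-congruent {l} {m} {y} {z} κ≡ =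
      ≡-mod-cancel-unit u v (≡-mod-weaken 2f∣a u-invertible)
        (≡-mod-cancel-multiples m z (≡-mod-weaken 2f∣a κ≡))

    cancel-2f : ∀ s {p q} → u * s + p * (2 * f) ≡ u * s + q * (2 * f) mod a → p ≡ q mod h
    cancel-2f s {p} {q} congruent =
      ≡-mod-cancelʳ-* (2 * f) (subst (λ n → p * (2 * f) ≡ q * (2 * f) mod n) (square-of-double h)
        (≡-mod-cancelˡ-+ (u * s) congruent))

    same-sum : ∀ {l m y z} → l + m ≡ y + z → κ l m ≡ κ y z mod a → m < h → z < h → m ≡ z
    same-sum {l} {m} {y} {z} l+m≡y+z κ≡ m<h z<h =
      ≡-mod⇒≡ (cancel-2f (y + z) (subst (λ s → u * s + m * (2 * f) ≡ κ y z mod a) l+m≡y+z κ≡)) m<h z<h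

    shifted-sum : ∀ {l m y z} → l + m ≡ y + z + 2 * f → κ l m ≡ κ y z mod a → ¬ D l m
    shifted-sum {l} {m} {y} {z} l+m≡ κ≡ (((_ , l<u+h) , (_ , m<h)) , ¬corner) =
      ¬corner ((u≤l , l<u+h) , (g≤m , m<h))
      where
      shift : ∀ u f y z m → u * (y + z + 2 * f) + m * (2 * f) ≡ u * (y + z) + (u + m) * (2 * f)
      shift = solve-∀
      split-u : ∀ h d m → 3 * h + d + m ≡ d + m + 3 * h
      split-u = solve-∀
      split-l : ∀ h d m → 3 * h + d + h + m ≡ d + m + 2 * (2 * h)
      split-l = solve-∀
      split-2f : ∀ g d y z → let h = g + d; f = 2 * h; u = 3 * h + d in y + z + 2 * f ≡ y + u + (g + z)
      split-2f = solve-∀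

      u+m≡z : u + m ≡ z mod h
      u+m≡z = cancel-2f (y + z) (subst (_≡ κ y z mod a) (shift u f y z m)
                (subst (λ s → u * s + m * (2 * f) ≡ κ y z mod a) l+m≡ κ≡))

      d+m≡z : d + m ≡ z mod h
      d+m≡z = ≡-mod-cancel-multiples 3 0
                (subst₂ (λ p q → p ≡ q mod h) (split-u h d m) (sym (+-identityʳ z)) u+m≡z)

      z<d+m : z < d + m
      z<d+m = +-cancelʳ-< (2 * f) z (d + m) (begin-strict
        z + 2 * f       ≤⟨ +-monoˡ-≤ (2 * f) (m≤n+m z y) ⟩
        y + z + 2 * f   ≡⟨ l+m≡ ⟨
        l + m           <⟨ +-monoˡ-< m l<u+h ⟩
        u + h + m       ≡⟨ split-l h d m ⟩
        d + m + 2 * f   ∎)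
        where open ≤-Reasoning

      m≡g+z : m ≡ g + z
      m≡g+z = excess-is-g d+m≡z z<d+m m<h

      g≤m : g ≤ m
      g≤m = subst (g ≤_) (sym m≡g+z) (m≤m+n g z)

      u≤l : u ≤ l
      u≤l = subst (u ≤_) (sym l≡y+u) (m≤n+m u y)
        where
        open ≡-Reasoning
        l≡y+u : l ≡ y + u
        l≡y+u = +-cancelʳ-≡ (g + z) l (y + u) (begin
          l + (g + z)     ≡⟨ cong (_+_ l) m≡g+z ⟨
          l + m           ≡⟨ l+m≡ ⟩
          y + z + 2 * f   ≡⟨ split-2f g d y z ⟩
          y + u + (g + z) ∎)

    incongruent-ordered : ∀ {l m y z} → D l m → D y z → y + z ≤ l + m →
                          l * b + m * c ≡ y * b + z * c mod a → l ≡ y × m ≡ z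
    incongruent-ordered {l} {m} {y} {z} lm∈D@((_ , (_ , m<h)) , _) ((_ , (_ , z<h)) , _)
                        y+z≤l+m congruent =
      [ same , (λ shifted → ⊥-elim (shifted-sum {l} {m} {y} {z} shifted κ≡ lm∈D)) ]′
        (sum-cases {l} {m} {y} {z} lm∈D y+z≤l+m (sums-congruent {l} {m} {y} {z} κ≡))
      where
      κ≡ : κ l m ≡ κ y z mod a
      κ≡ = κ-congruent {l} {m} {y} {z} congruent
      same : l + m ≡ y + z → l ≡ y × m ≡ z
      same l+m≡y+z = +-cancelʳ-≡ m l y (trans l+m≡y+z (cong (_+_ y) (sym m≡z))) , m≡z
        where
        m≡z : m ≡ z
        m≡z = same-sum {l} {m} {y} {z} l+m≡y+z κ≡ m<h z<h

    incongruent : ∀ {l m y z} → D l m → D y z →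
                  l * b + m * c ≡ y * b + z * c mod a → l * b + m * c ≡ y * b + z * c
    incongruent {l} {m} {y} {z} lm∈D yz∈D congruent with ≤-total (y + z) (l + m)
    ... | inj₁ y+z≤l+m = uncurry (cong₂ value) (incongruent-ordered lm∈D yz∈D y+z≤l+m congruent)
    ... | inj₂ l+m≤y+z =
      sym (uncurry (cong₂ value) (incongruent-ordered yz∈D lm∈D l+m≤y+z (≡-mod-sym congruent)))

    open AperyFromDomain a b c D D? reducible incongruent using (apery)

    apery-description : ∀ {f₀ f₁ f₂ L M g′} → f₀ ≡ f → f₁ ≡ u → f₂ ≡ u + f → L ≡ u + h → M ≡ h → g′ ≡ g →
                        ∀ s → AperyDescription f₀ f₁ f₂ L M g′ s
    apery-description refl refl refl refl refl refl s =
      mk⇔ (map₂ (map₂ assocʳ′) ∘ Equivalence.to (apery s))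
          (Equivalence.from (apery s) ∘ map₂ (map₂ assocˡ′))

module FibonacciShape (j d e : ℕ) (fib-j : fib j ≡ d * 2) (fib-1+j : fib (suc j) ≡ suc e) where

  open FundamentalDomain d e

  n : ℕ
  n = 3 + j

  fib-shape : ∀ i → fib (i + suc j) ≡ fib (suc i) * g + fib i * (d * 2)
  fib-shape i = trans (fib-+ i j) (cong₂ (λ p q → fib (suc i) * p + fib i * q) fib-1+j fib-j)

  fib[2+j]≡h+d : fib (2 + j) ≡ h + d
  fib[2+j]≡h+d = trans (fib-shape 1) (identity g d)
    where
    identity : ∀ g d → 1 * g + 1 * (d * 2) ≡ g + d + d
    identity = solve-∀

  fib[n]≡f : fib n ≡ f
  fib[n]≡f = trans (fib-shape 2) (identity g d)
    where
    identity : ∀ g d → 2 * g + 1 * (d * 2) ≡ 2 * (g + d)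
    identity = solve-∀

  fib[4+j]≡u : fib (4 + j) ≡ u
  fib[4+j]≡u = trans (fib-shape 3) (identity g d)
    where
    identity : ∀ g d → 3 * g + 2 * (d * 2) ≡ 3 * (g + d) + d
    identity = solve-∀

  fib[n+1]≡u : fib (n + 1) ≡ u
  fib[n+1]≡u = trans (cong (λ k → fib (3 + k)) (+-comm j 1)) fib[4+j]≡u

  fib[n+2]≡u+f : fib (n + 2) ≡ u + f
  fib[n+2]≡u+f = trans (cong (λ k → fib (3 + k)) (+-comm j 2)) (trans (fib-shape 4) (identity g d))
    where
    identity : ∀ g d → 5 * g + 3 * (d * 2) ≡ 3 * (g + d) + d + 2 * (g + d)
    identity = solve-∀

  fib[n+3]/2≡u+h : fib (n + 3) / 2 ≡ u + h
  fib[n+3]/2≡u+h = trans (cong (_/ 2) fib[n+3]≡[u+h]*2) (m*n/n≡m (u + h) 2)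
    where
    identity : ∀ g d → 8 * g + 5 * (d * 2) ≡ (3 * (g + d) + d + (g + d)) * 2
    identity = solve-∀
    fib[n+3]≡[u+h]*2 : fib (n + 3) ≡ (u + h) * 2
    fib[n+3]≡[u+h]*2 = trans (cong (λ k → fib (3 + k)) (+-comm j 3)) (trans (fib-shape 5) (identity g d))

  fib[n]/2≡h : fib n / 2 ≡ h
  fib[n]/2≡h = trans (cong (_/ 2) (trans fib[n]≡f (*-comm 2 h))) (m*n/n≡m h 2)

  u-invertible : u * (u * (h + d) * (h + d)) ≡ 1 mod a
  u-invertible = subst₂ (λ x m → x ≡ 1 mod m)
    (cong₂ (λ w v → v * (v * w * w)) fib[2+j]≡h+d fib[4+j]≡u) (cong₂ _*_ fib[n]≡f fib[n]≡f)
    (adjacent⇒invertible {fib (2 + j)} {fib (4 + j)} (cassini (2 + j)))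

  apery-fib : ∀ s → AperyDescription (fib n) (fib (n + 1)) (fib (n + 2))
                                     (fib (n + 3) / 2) (fib n / 2) (fib (n ∸ 2)) s
  apery-fib = apery-description u-invertible
    fib[n]≡f fib[n+1]≡u fib[n+2]≡u+f fib[n+3]/2≡u+h fib[n]/2≡h fib-1+j

fibonacci-apery : ∀ j → 2 ∣ℕ fib j → ∀ s →
  AperyDescription (fib (3 + j)) (fib (3 + j + 1)) (fib (3 + j + 2))
                   (fib (3 + j + 3) / 2) (fib (3 + j) / 2) (fib (3 + j ∸ 2)) s
fibonacci-apery j (ℕ∣.divides d fib-j) with e , 1+e≡fib[1+j] ← m≤n⇒∃[o]m+o≡n (0<fib[1+n] j) =
  FibonacciShape.apery-fib j d e fib-j (sym 1+e≡fib[1+j])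

-- The hypothesis 2 ≤ k is only used to exclude k = 0.
proposition5p7 : (k n : ℕ) → 2 ≤ k → n ≡ 3 * k → (s : ℕ) →
    InApery (fib n * fib n) (fib (n + 1) * fib (n + 1)) (fib (n + 2) * fib (n + 2)) (fib n * fib n) s
    ⇔ (∃ λ l → ∃ λ μ →
        (InRange 0 (fib (n + 3) / 2) l × InRange 0 (fib n / 2) μ)
        × ¬ (InRange (fib (n + 1)) (fib (n + 3) / 2) l × InRange (fib (n ∸ 2)) (fib n / 2) μ)
        × s ≡ l * (fib (n + 1) * fib (n + 1)) + μ * (fib (n + 2) * fib (n + 2)))
proposition5p7 zero    _ ()  _    _
proposition5p7 (suc k) n _   n≡3k s rewrite trans n≡3k (*-suc 3 k) =
  fibonacci-apery (3 * k) (2∣fib[3k] k) s
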